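{- Let $\kappa\ge 2$. The number of tiles $\tau$ of a $\kappa$-doku tiling with $\rho$ runs satisfies \[ \tau\ge \kappa\rho-\left\lfloor \frac{\rho^2}{3}\right\rfloor. \]
   Context: A tile is a closed rhombus of unit side with interior angles $60^\circ$ and $120^\circ$, placed so that its edges lie on a fixed triangular lattice of the plane. Two tiles are adjacent if they share a full common edge. A run is a maximal sequence $T_1,\dots,T_k$ ($k\ge 2$) of distinct tiles such that $T_i$ and $T_{i+1}$ share an edge $e_i$, all the $e_i$ are parallel, and for $1<i<k$ the edges $e_{i-1},e_i$ are opposite edges of $T_i$. For an integer $\kappa\ge2$, a $\kappa$-doku tiling is a finite set of tiles such that: (P1) the adjacency graph on the tiles is connected; (P2) any two tiles are disjoint, meet in exactly one common vertex, or share a full common edge; (P3) after removing any single tile, the remaining tiles are still connected, where two tiles are considered joined if they have nonempty intersection; every run consists of exactly $\kappa$ tiles; and (no holes) the complement of the union of the tiles is connected. $\tau$ is the number of tiles and $\rho$ the number of runs. -}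

module Defs where

open import Data.Nat using (ℕ; _≤_)
open import Data.Integer using (ℤ; _+_; _-_; 0ℤ; 1ℤ; -1ℤ)
open import Data.Product using (_×_; _,_; ∃; ∃-syntax; proj₁; proj₂)
open import Data.Sum using (_⊎_)
open import Data.List using (List; []; _∷_; _++_; length)
open import Data.List.Membership.Propositional using (_∈_)
open import Data.List.Relation.Unary.Unique.Propositional using (Unique)
open import Data.List.Relation.Unary.All using (All)
open import Data.List.Relation.Unary.AllPairs using (AllPairs)
open import Data.List using (reverse)
open import Relation.Binary.PropositionalEquality using (_≡_; _≢_)
open import Relation.Nullary using (¬_)

-- The triangular lattice, in oblique coordinates: the point (a , b)
-- is a·1 + b·ω with ω = e^{iπ/3}.  The lattice cuts the plane into
-- unit equilateral triangles ("up" and "down"), lattice edges and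
-- lattice vertices; every closed tile is a union of such cells.

Point : Set
Point = ℤ × ℤ

data Dir : Set where
  d0 d1 d2 : Dir

δ : Dir → Point
δ d0 = (1ℤ , 0ℤ)
δ d1 = (0ℤ , 1ℤ)
δ d2 = (-1ℤ , 1ℤ)

_⊕_ : Point → Point → Point
(a , b) ⊕ (c , d) = (a + c , b + d)

record Edge : Set where
  constructor edge
  field
    start : Point
    dir   : Dir
open Edge public

Endpoint : Edge → Point → Set
Endpoint (edge p d) q = q ≡ p ⊎ q ≡ (p ⊕ δ d)

Parallel : Edge → Edge → Set
Parallel e f = dir e ≡ dir f

data Shape : Set where
  up down : Shape

record Tri : Set where
  constructor tri
  field
    corner : Point
    shape  : Shape

TriVertex : Tri → Point → Set
TriVertex (tri (a , b) up)   p = p ≡ (a , b) ⊎ p ≡ (a + 1ℤ , b) ⊎ p ≡ (a , b + 1ℤ)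
TriVertex (tri (a , b) down) p =
  p ≡ (a + 1ℤ , b) ⊎ p ≡ (a , b + 1ℤ) ⊎ p ≡ (a + 1ℤ , b + 1ℤ)

TriEdge : Tri → Edge → Set
TriEdge (tri (a , b) up)   e =
  e ≡ edge (a , b) d0 ⊎ e ≡ edge (a , b) d1 ⊎ e ≡ edge (a + 1ℤ , b) d2
TriEdge (tri (a , b) down) e =
  e ≡ edge (a , b + 1ℤ) d0 ⊎ e ≡ edge (a + 1ℤ , b) d1 ⊎ e ≡ edge (a + 1ℤ , b) d2

-- A closed 60°/120° rhombus of unit side with edges on the
-- lattice is exactly the union of the two unit triangles on either
-- side of a lattice edge (its short diagonal); we identify a tile with
-- that diagonal.

record Tile : Set where
  constructor tile
  field
    diagonal : Edge
open Tile public

tileTris : Tile → Tri × Tri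
tileTris (tile (edge (a , b) d0)) = tri (a , b) up , tri (a , b - 1ℤ) down
tileTris (tile (edge (a , b) d1)) = tri (a , b) up , tri (a - 1ℤ , b) down
tileTris (tile (edge (a , b) d2)) = tri (a - 1ℤ , b) up , tri (a - 1ℤ , b) down

TileTri : Tile → Tri → Set
TileTri t x = x ≡ proj₁ (tileTris t) ⊎ x ≡ proj₂ (tileTris t)

TileVertex : Tile → Point → Set
TileVertex t p = ∃[ x ] (TileTri t x × TriVertex x p)

EdgeInTile : Tile → Edge → Set
EdgeInTile t e = ∃[ x ] (TileTri t x × TriEdge x e)

Side : Tile → Edge → Set
Side t e = EdgeInTile t e × e ≢ diagonal t

Opposite : Tile → Edge → Edge → Set
Opposite t e f = Side t e × Side t f × Parallel e f × e ≢ f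

Adjacent : Tile → Tile → Set
Adjacent t u = ∃[ e ] (Side t e × Side u e)

-- nonempty intersection of the closed tiles (the intersection of two
-- subcomplexes is a subcomplex, so it is nonempty iff it contains a
-- lattice vertex)
Meet : Tile → Tile → Set
Meet t u = ∃[ p ] (TileVertex t p × TileVertex u p)

CommonVertex : Tile → Tile → Point → Set
CommonVertex t u p = TileVertex t p × TileVertex u p

NoCommonTri : Tile → Tile → Set
NoCommonTri t u = ∀ x → TileTri t x → ¬ TileTri u x

GoodPair : Tile → Tile → Set
GoodPair t u =
    (¬ Meet t u)
  ⊎ (NoCommonTri t u × ∃[ p ] (CommonVertex t u p × (∀ q → CommonVertex t u q → q ≡ p)))
  ⊎ (NoCommonTri t u × ∃[ e ] (Side t e × Side u e × (∀ q → CommonVertex t u q → Endpoint e q)))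

data Reach {A : Set} (P : A → Set) (R : A → A → Set) : A → A → Set where
  here  : ∀ {a} → Reach P R a a
  there : ∀ {a b c} → R a b → P b → Reach P R b c → Reach P R a c

Connected : {A : Set} → (A → Set) → (A → A → Set) → Set
Connected P R = ∀ a b → P a → P b → Reach P R a b

-- ChainAfter t e us : we are at tile t, entered through its side e,
-- and the sequence continues with the tiles us; each next edge is
-- opposite to the previous one in the current tile.
data ChainAfter : Tile → Edge → List Tile → Set where
  end  : ∀ {t e} → ChainAfter t e []
  step : ∀ {t e f u us} → Opposite t e f → Side u f →
         ChainAfter u f us → ChainAfter t e (u ∷ us)

-- T₁,…,T_k (k ≥ 2), T_i and T_{i+1} share the side e_i, all e_i are
-- parallel and e_{i-1}, e_i are opposite sides of T_i for 1<i<k.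
data IsChain : List Tile → Set where
  chain : ∀ {t u e us} → Side t e → Side u e → ChainAfter u e us →
          IsChain (t ∷ u ∷ us)

ChainIn : List Tile → List Tile → Set
ChainIn T r = IsChain r × Unique r × All (_∈ T) r

-- a run of T: a maximal chain of distinct tiles of T (not a proper
-- contiguous part of a longer one)
IsRun : List Tile → List Tile → Set
IsRun T r = ChainIn T r ×
  (∀ xs ys → ChainIn T (xs ++ r ++ ys) → xs ≡ [] × ys ≡ [])

-- Rs lists every run of T exactly once, a run and its reversal being
-- the same run.
RunList : List Tile → List (List Tile) → Set
RunList T Rs =
    All (IsRun T) Rs
  × (∀ r → IsRun T r → r ∈ Rs ⊎ reverse r ∈ Rs)
  × AllPairs (λ r s → r ≢ s × r ≢ reverse s) Rs

-- No holes: the complement of the union of the tiles is connected.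
-- The complement is the open set made of the uncovered open triangles,
-- open edges and vertices; it is connected iff the uncovered triangles
-- are connected through uncovered edges.

UncoveredTri : List Tile → Tri → Set
UncoveredTri T x = ∀ t → t ∈ T → ¬ TileTri t x

UncoveredEdge : List Tile → Edge → Set
UncoveredEdge T e = ∀ t → t ∈ T → ¬ EdgeInTile t e

ComplementStep : List Tile → Tri → Tri → Set
ComplementStep T x y = ∃[ e ] (TriEdge x e × TriEdge y e × UncoveredEdge T e)

NoHoles : List Tile → Set
NoHoles T = Connected (UncoveredTri T) (ComplementStep T)

-- κ-doku tilings (a finite set of tiles = a duplicate-free list).

record IsDoku (κ : ℕ) (T : List Tile) : Set where
  field
    distinct  : Unique T
    P1        : Connected (_∈ T) Adjacent
    P2        : ∀ t u → t ∈ T → u ∈ T → t ≢ u → GoodPair t u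
    P3        : ∀ t → t ∈ T → Connected (λ x → x ∈ T × x ≢ t) Meet
    runLength : ∀ r → IsRun T r → length r ≡ κ
    noHoles   : NoHoles T

-- Each run is a track of some class c (the direction of the sides its
-- consecutive tiles share), and can be read in ascending order, from low sides to high
-- sides.  In a tiling without overlaps a tile has at most one predecessor and one
-- successor of each class, so two runs of the same class are disjoint.  Along a track of
-- class c, suitable linear functionals of the tile positions are monotone, so tracks of
-- different classes cross at most once: runs of different classes share at most one tile.
-- Double counting the incidences with Bonferroni's inequality gives
-- κρ ≤ τ + #{pairs of runs of different classes}, and a 3-colouring of ρ objects has at
-- most ρ²/3 bichromatic pairs.

module Submission where

open import Defs
open import Data.Nat using (ℕ; _≤_; _*_; _∸_; _/_)
open import Data.List using (List; length)

open import Data.Nat using (suc; z≤n; s≤s)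
open import Data.Nat.Properties using (suc-injective)
open import Data.List using ([]; _∷_; _++_; map; reverse; reverseAcc)
open import Data.Nat.ListAction using (sum)
open import Data.List.Properties
  using (++-identityʳ; unfold-reverse; reverse-involutive; reverse-injective; length-reverse)
open import Data.List.Membership.Propositional using (_∈_)
open import Data.List.Relation.Unary.Any using (here; there)
open import Data.List.Relation.Unary.Any.Properties using (reverse⁺; reverse⁻)
open import Data.List.Relation.Unary.All as All using (All; []; _∷_)
import Data.List.Relation.Unary.All.Properties as All
open import Data.List.Relation.Unary.AllPairs as AllPairs using (AllPairs; []; _∷_)
open import Data.List.Relation.Unary.Unique.Propositional using (Unique)
import Data.List.Relation.Unary.Unique.Propositional.Properties as Unique
open import Data.List.Relation.Unary.Linked as Linked using (Linked; []; [-]; _∷_)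
open import Data.List.Relation.Unary.Linked.Properties using (Linked⇒AllPairs)
open import Data.List.Relation.Binary.Disjoint.Propositional using (Disjoint)
open import Data.Bool using (if_then_else_)
open import Data.Product using (_×_; _,_; proj₁; ∃; ∃-syntax)
open import Data.Product.Properties using (≡-dec)
open import Data.Sum using (_⊎_; inj₁; inj₂; [_,_]′; swap)
open import Data.Empty using (⊥; ⊥-elim)
open import Function using (_∘_; flip)
open import Level using (0ℓ)
open import Relation.Nullary using (¬_; Dec; yes; no; ¬?; does; _×-dec_)
open import Relation.Nullary.Decidable using (map′)
open import Relation.Unary using (Decidable)
open import Relation.Binary.Core using (Rel)
open import Relation.Binary.Definitions using (DecidableEquality)
open import Relation.Binary.PropositionalEquality hiding ([_])
open import Relation.Binary.Construct.Closure.Transitive using (TransClosure; [_]; _∷_; transitive)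

everywhere : {P : Dir → Set} → P d0 → P d1 → P d2 → ∀ d → P d
everywhere p₀ p₁ p₂ d0 = p₀
everywhere p₀ p₁ p₂ d1 = p₁
everywhere p₀ p₁ p₂ d2 = p₂

_≟ᵈ_ : DecidableEquality Dir
d0 ≟ᵈ d0 = yes refl
d1 ≟ᵈ d1 = yes refl
d2 ≟ᵈ d2 = yes refl
d0 ≟ᵈ d1 = no λ ()
d0 ≟ᵈ d2 = no λ ()
d1 ≟ᵈ d0 = no λ ()
d1 ≟ᵈ d2 = no λ ()
d2 ≟ᵈ d0 = no λ ()
d2 ≟ᵈ d1 = no λ ()

module _ {A : Set} {R : Rel A 0ℓ} where

  Linked-reverse : ∀ {xs} → Linked R xs → Linked (flip R) (reverse xs)
  Linked-reverse {[]}     []     = []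
  Linked-reverse {x ∷ xs} linked = go linked [-]
    where
    go : ∀ {x xs acc} → Linked R (x ∷ xs) → Linked (flip R) (x ∷ acc) →
         Linked (flip R) (reverseAcc (x ∷ acc) xs)
    go [-]         acc = acc
    go (Rxy ∷ Rxs) acc = go Rxs (Rxy ∷ acc)

  AllPairs-∈ : ∀ {xs x y} → AllPairs R xs → x ∈ xs → y ∈ xs → x ≢ y → R x y ⊎ R y x
  AllPairs-∈ (_  ∷ _)  (here refl) (here refl) x≢y = ⊥-elim (x≢y refl)
  AllPairs-∈ (Rx ∷ _)  (here refl) (there y∈)  _   = inj₁ (All.lookup Rx y∈)
  AllPairs-∈ (Ry ∷ _)  (there x∈)  (here refl) _   = inj₂ (All.lookup Ry x∈)
  AllPairs-∈ (_  ∷ Rs) (there x∈)  (there y∈)  x≢y = AllPairs-∈ Rs x∈ y∈ x≢y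

module _ {A : Set} {P : A → Set} where

  length-toList : ∀ {xs} (pxs : All P xs) → length (All.toList pxs) ≡ length xs
  length-toList []         = refl
  length-toList (_ ∷ pxs) = cong suc (length-toList pxs)

  All-toList : {Q : ∃ P → Set} → (∀ {x} (px : P x) → Q (x , px)) → ∀ {xs} (pxs : All P xs) →
               All Q (All.toList pxs)
  All-toList f []         = []
  All-toList f (px ∷ pxs) = f px ∷ All-toList f pxs

  AllPairs-toList : {R : A → A → Set} {S : ∃ P → ∃ P → Set} →
    (∀ {x y} → R x y → (px : P x) (py : P y) → S (x , px) (y , py)) →
    ∀ {xs} → AllPairs R xs → (pxs : All P xs) → AllPairs S (All.toList pxs)
  AllPairs-toList f []         []         = []
  AllPairs-toList {R} {S} f (Rx ∷ Rxs) (px ∷ pxs) = first Rx pxs ∷ AllPairs-toList f Rxs pxs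
    where
    first : ∀ {ys} → All (R _) ys → (pys : All P ys) → All (S (_ , px)) (All.toList pys)
    first []         []         = []
    first (Rxy ∷ Rs) (py ∷ pys) = f Rxy px py ∷ first Rs pys

module Counting where

  open import Data.Nat using (_+_)
  open import Data.Nat.Properties
  open import Data.Nat.DivMod using (m*n/n≡m; /-monoˡ-≤)
  open import Data.Nat.Tactic.RingSolver using (solve-∀)

  private variable
    B C : Set

  𝟙 : {P : Set} → Dec P → ℕ
  𝟙 p = if does p then 1 else 0

  ∑ : List B → (B → ℕ) → ℕ
  ∑ xs f = sum (map f xs)

  ∑-pairs : List B → (B → B → ℕ) → ℕ
  ∑-pairs []       f = 0
  ∑-pairs (x ∷ xs) f = ∑ xs (f x) + ∑-pairs xs f

  ∑-cong : (xs : List B) {f g : B → ℕ} → (∀ x → f x ≡ g x) → ∑ xs f ≡ ∑ xs g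
  ∑-cong []       eq = refl
  ∑-cong (x ∷ xs) eq = cong₂ _+_ (eq x) (∑-cong xs eq)

  ∑-mono-≤ : (xs : List B) {f g : B → ℕ} → All (λ x → f x ≤ g x) xs → ∑ xs f ≤ ∑ xs g
  ∑-mono-≤ []       []         = z≤n
  ∑-mono-≤ (x ∷ xs) (le ∷ les) = +-mono-≤ le (∑-mono-≤ xs les)

  ∑-zero : {xs : List B} {f : B → ℕ} → All (λ x → f x ≡ 0) xs → ∑ xs f ≡ 0
  ∑-zero []         = refl
  ∑-zero (eq ∷ eqs) = cong₂ _+_ eq (∑-zero eqs)

  ∑-const : (xs : List B) (k : ℕ) → ∑ xs (λ _ → k) ≡ length xs * k
  ∑-const []       k = refl
  ∑-const (x ∷ xs) k = cong (k +_) (∑-const xs k)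

  ∑-+ : (xs : List B) (f g : B → ℕ) → ∑ xs (λ x → f x + g x) ≡ ∑ xs f + ∑ xs g
  ∑-+ []       f g = refl
  ∑-+ (x ∷ xs) f g = trans (cong (f x + g x +_) (∑-+ xs f g)) (+-interchange (f x) (g x) _ _)
    where
    +-interchange : ∀ a b c d → (a + b) + (c + d) ≡ (a + c) + (b + d)
    +-interchange = solve-∀

  ∑-comm : (xs : List B) (ys : List C) (f : B → C → ℕ) →
           ∑ xs (λ x → ∑ ys (f x)) ≡ ∑ ys (λ y → ∑ xs (λ x → f x y))
  ∑-comm []       ys f = sym (∑-zero (All.tabulate {xs = ys} (λ _ → refl)))
  ∑-comm (x ∷ xs) ys f = trans (cong (∑ ys (f x) +_) (∑-comm xs ys f))
                               (sym (∑-+ ys (f x) (λ y → ∑ xs (λ x → f x y))))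

  ∑-∑-pairs-comm : (ys : List C) (xs : List B) (f : C → B → B → ℕ) →
                   ∑ ys (λ y → ∑-pairs xs (f y)) ≡ ∑-pairs xs (λ x x′ → ∑ ys (λ y → f y x x′))
  ∑-∑-pairs-comm ys []       f = ∑-zero (All.tabulate {xs = ys} (λ _ → refl))
  ∑-∑-pairs-comm ys (x ∷ xs) f =
    trans (∑-+ ys (λ y → ∑ xs (f y x)) (λ y → ∑-pairs xs (f y)))
          (cong₂ _+_ (∑-comm ys xs (λ y → f y x)) (∑-∑-pairs-comm ys xs f))

  ∑-pairs-mono-≤ : {xs : List B} {f g : B → B → ℕ} → AllPairs (λ x y → f x y ≤ g x y) xs →
                   ∑-pairs xs f ≤ ∑-pairs xs g
  ∑-pairs-mono-≤ []         = z≤n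
  ∑-pairs-mono-≤ (le ∷ les) = +-mono-≤ (∑-mono-≤ _ le) (∑-pairs-mono-≤ les)

  ∑𝟙≤1+∑-pairs𝟙 : (xs : List B) {P : B → Set} (P? : Decidable P) →
                  ∑ xs (λ x → 𝟙 (P? x)) ≤ 1 + ∑-pairs xs (λ x y → 𝟙 (P? x ×-dec P? y))
  ∑𝟙≤1+∑-pairs𝟙 []       P? = z≤n
  ∑𝟙≤1+∑-pairs𝟙 (x ∷ xs) P? with P? x
  ... | yes _ = s≤s (m≤m+n _ _)
  ... | no _  = ≤-trans (∑𝟙≤1+∑-pairs𝟙 xs P?)
                        (+-monoʳ-≤ 1 (m≤n+m _ (∑ xs (λ _ → 0))))

  ∑𝟙≡0 : (xs : List B) {P : B → Set} (P? : Decidable P) → (∀ {x} → ¬ P x) →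
         ∑ xs (λ x → 𝟙 (P? x)) ≡ 0
  ∑𝟙≡0 []       P? ¬P = refl
  ∑𝟙≡0 (x ∷ xs) P? ¬P with P? x
  ... | yes Px = ⊥-elim (¬P Px)
  ... | no _   = ∑𝟙≡0 xs P? ¬P

  ∑𝟙≤1 : {xs : List B} {P : B → Set} (P? : Decidable P) → Unique xs →
         (∀ {x y} → P x → P y → x ≡ y) → ∑ xs (λ x → 𝟙 (P? x)) ≤ 1
  ∑𝟙≤1 {xs = []}     P? _            P-unique = z≤n
  ∑𝟙≤1 {xs = x ∷ xs} P? (x∉xs ∷ uniq) P-unique with P? x
  ... | no _   = ∑𝟙≤1 P? uniq P-unique
  ... | yes Px = ≤-reflexive (cong suc (∑-zero (All.tabulate vanishes)))
    where
    vanishes : ∀ {y} → y ∈ xs → 𝟙 (P? y) ≡ 0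
    vanishes {y} y∈xs with P? y
    ... | yes Py = ⊥-elim (All.lookup x∉xs y∈xs (P-unique Px Py))
    ... | no _   = refl

  bichromatic : Dir → Dir → ℕ
  bichromatic c c′ = 𝟙 (¬? (c ≟ᵈ c′))

  module _ (colour : B → Dir) where

    count : Dir → List B → ℕ
    count k xs = ∑ xs (λ x → 𝟙 (k ≟ᵈ colour x))

    length≡∑count : ∀ xs → length xs ≡ count d0 xs + count d1 xs + count d2 xs
    length≡∑count []       = refl
    length≡∑count (x ∷ xs) with colour x | length≡∑count xs
    ... | d0 | eq = cong suc eq
    ... | d1 | eq = trans (cong suc eq) (+-suc-middle (count d0 xs) (count d1 xs) (count d2 xs))
      where
      +-suc-middle : ∀ a b c → suc (a + b + c) ≡ a + suc b + c
      +-suc-middle = solve-∀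
    ... | d2 | eq = trans (cong suc eq) (+-suc-last (count d0 xs) (count d1 xs) (count d2 xs))
      where
      +-suc-last : ∀ a b c → suc (a + b + c) ≡ a + b + suc c
      +-suc-last = solve-∀

    ∑-bichromatic : ∀ k k₁ k₂ → (∀ c → bichromatic k c ≡ 𝟙 (k₁ ≟ᵈ c) + 𝟙 (k₂ ≟ᵈ c)) →
                    ∀ xs → ∑ xs (λ y → bichromatic k (colour y)) ≡ count k₁ xs + count k₂ xs
    ∑-bichromatic k k₁ k₂ split xs =
      trans (∑-cong xs (λ y → split (colour y))) (∑-+ xs _ _)

    ∑-pairs-bichromatic : ∀ xs → ∑-pairs xs (λ x y → bichromatic (colour x) (colour y)) ≡
      count d0 xs * count d1 xs + count d0 xs * count d2 xs + count d1 xs * count d2 xs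
    ∑-pairs-bichromatic []       = refl
    ∑-pairs-bichromatic (x ∷ xs) with colour x
    ... | d0 = trans (cong₂ _+_ (∑-bichromatic d0 d1 d2 (λ { d0 → refl ; d1 → refl ; d2 → refl }) xs)
                                (∑-pairs-bichromatic xs))
                     (expand (count d0 xs) (count d1 xs) (count d2 xs))
      where
      expand : ∀ a b c → (b + c) + (a * b + a * c + b * c) ≡ suc a * b + suc a * c + b * c
      expand = solve-∀
    ... | d1 = trans (cong₂ _+_ (∑-bichromatic d1 d0 d2 (λ { d0 → refl ; d1 → refl ; d2 → refl }) xs)
                                (∑-pairs-bichromatic xs))
                     (expand (count d0 xs) (count d1 xs) (count d2 xs))
      where
      expand : ∀ a b c → (a + c) + (a * b + a * c + b * c) ≡ a * suc b + a * c + suc b * c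
      expand = solve-∀
    ... | d2 = trans (cong₂ _+_ (∑-bichromatic d2 d0 d1 (λ { d0 → refl ; d1 → refl ; d2 → refl }) xs)
                                (∑-pairs-bichromatic xs))
                     (expand (count d0 xs) (count d1 xs) (count d2 xs))
      where
      expand : ∀ a b c → (a + b) + (a * b + a * c + b * c) ≡ a * b + a * suc c + b * suc c
      expand = solve-∀

  2ab≤a²+b² : ∀ a b → 2 * (a * b) ≤ a * a + b * b
  2ab≤a²+b² a b = [ ordered , swapped ]′ (≤-total a b)
    where
    ordered : ∀ {a b} → a ≤ b → 2 * (a * b) ≤ a * a + b * b
    ordered {a} a≤b with m≤n⇒∃[o]m+o≡n a≤b
    ... | k , refl = subst (2 * (a * (a + k)) ≤_) (expand a k) (m≤m+n _ (k * k))
      where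
      expand : ∀ a k → 2 * (a * (a + k)) + k * k ≡ a * a + (a + k) * (a + k)
      expand = solve-∀
    swapped : b ≤ a → 2 * (a * b) ≤ a * a + b * b
    swapped b≤a = subst₂ _≤_ (cong (2 *_) (*-comm b a)) (+-comm (b * b) (a * a)) (ordered b≤a)

  3[ab+ac+bc]≤[a+b+c]² : ∀ a b c → (a * b + a * c + b * c) * 3 ≤ (a + b + c) * (a + b + c)
  3[ab+ac+bc]≤[a+b+c]² a b c = begin
    (a * b + a * c + b * c) * 3                           ≡⟨ split-off-2× a b c ⟩
    (a * b + a * c + b * c) + 2 * (a * b + a * c + b * c) ≤⟨ +-monoˡ-≤ (2 * (a * b + a * c + b * c)) S≤Q ⟩
    (a * a + b * b + c * c) + 2 * (a * b + a * c + b * c) ≡⟨ square-expansion a b c ⟩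
    (a + b + c) * (a + b + c)                             ∎
    where
    open ≤-Reasoning
    split-off-2× : ∀ a b c →
      (a * b + a * c + b * c) * 3 ≡ (a * b + a * c + b * c) + 2 * (a * b + a * c + b * c)
    split-off-2× = solve-∀
    square-expansion : ∀ a b c →
      (a * a + b * b + c * c) + 2 * (a * b + a * c + b * c) ≡ (a + b + c) * (a + b + c)
    square-expansion = solve-∀
    distribute-2× : ∀ a b c → 2 * (a * b + a * c + b * c) ≡ 2 * (a * b) + 2 * (a * c) + 2 * (b * c)
    distribute-2× = solve-∀
    collect-squares : ∀ a b c →
      (a * a + b * b) + (a * a + c * c) + (b * b + c * c) ≡ 2 * (a * a + b * b + c * c)
    collect-squares = solve-∀
    S≤Q : a * b + a * c + b * c ≤ a * a + b * b + c * c
    S≤Q = *-cancelˡ-≤ 2 (begin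
      2 * (a * b + a * c + b * c)                         ≡⟨ distribute-2× a b c ⟩
      2 * (a * b) + 2 * (a * c) + 2 * (b * c)
        ≤⟨ +-mono-≤ (+-mono-≤ (2ab≤a²+b² a b) (2ab≤a²+b² a c)) (2ab≤a²+b² b c) ⟩
      (a * a + b * b) + (a * a + c * c) + (b * b + c * c) ≡⟨ collect-squares a b c ⟩
      2 * (a * a + b * b + c * c)                         ∎)

  ∑-pairs-bichromatic≤ : (colour : B → Dir) (xs : List B) →
    ∑-pairs xs (λ x y → bichromatic (colour x) (colour y)) ≤ (length xs * length xs) / 3
  ∑-pairs-bichromatic≤ colour xs = begin
    P             ≡⟨ m*n/n≡m P 3 ⟨
    P * 3 / 3     ≤⟨ /-monoˡ-≤ 3 (subst₂ (λ p l → p * 3 ≤ l * l)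
                       (sym (∑-pairs-bichromatic colour xs)) (sym (length≡∑count colour xs))
                       (3[ab+ac+bc]≤[a+b+c]² (count colour d0 xs) (count colour d1 xs) (count colour d2 xs))) ⟩
    (length xs * length xs) / 3 ∎
    where
    open ≤-Reasoning
    P = ∑-pairs xs (λ x y → bichromatic (colour x) (colour y))

  ColourSeparated : {A : Set} → Dir → List A → Dir → List A → Set
  ColourSeparated c r c′ s =
    (c ≡ c′ → Disjoint r s) × (c ≢ c′ → ∀ {x y} → x ∈ r × x ∈ s → y ∈ r × y ∈ s → x ≡ y)

  module _ {A : Set} (_≟_ : DecidableEquality A) where

    open import Data.List.Membership.DecPropositional _≟_ using (_∈?_)

    𝟙∈∷ : ∀ {x r} → ¬ x ∈ r → ∀ t → 𝟙 (t ∈? (x ∷ r)) ≡ 𝟙 (t ≟ x) + 𝟙 (t ∈? r)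
    𝟙∈∷ {x} {r} x∉r t with t ≟ x | t ∈? r
    ... | yes refl | yes t∈r = ⊥-elim (x∉r t∈r)
    ... | yes refl | no _    = refl
    ... | no _     | yes _   = refl
    ... | no _     | no _    = refl

    1≤∑𝟙≟ : ∀ {x T} → x ∈ T → 1 ≤ ∑ T (λ t → 𝟙 (t ≟ x))
    1≤∑𝟙≟ {x} (here refl) with x ≟ x
    ... | yes _   = s≤s z≤n
    ... | no x≢x  = ⊥-elim (x≢x refl)
    1≤∑𝟙≟ {x} {y ∷ T} (there x∈T) = ≤-trans (1≤∑𝟙≟ x∈T) (m≤n+m _ (𝟙 (y ≟ x)))

    length≤∑𝟙∈ : ∀ {T r} → Unique r → All (_∈ T) r → length r ≤ ∑ T (λ t → 𝟙 (t ∈? r))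
    length≤∑𝟙∈         {r = []}    _              _            = z≤n
    length≤∑𝟙∈ {T = T} {r = x ∷ r} (x∉r ∷ unique) (x∈T ∷ r⊆T) = begin
      1 + length r                                      ≤⟨ +-mono-≤ (1≤∑𝟙≟ x∈T) (length≤∑𝟙∈ unique r⊆T) ⟩
      ∑ T (λ t → 𝟙 (t ≟ x)) + ∑ T (λ t → 𝟙 (t ∈? r))  ≡⟨ ∑-+ T _ _ ⟨
      ∑ T (λ t → 𝟙 (t ≟ x) + 𝟙 (t ∈? r))              ≡⟨ ∑-cong T (𝟙∈∷ (λ x∈r → All.lookup x∉r x∈r refl)) ⟨
      ∑ T (λ t → 𝟙 (t ∈? (x ∷ r)))                    ∎
      where open ≤-Reasoning

    ∑-common≤bichromatic : ∀ {T c r c′ s} → Unique T → ColourSeparated c r c′ s →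
                           ∑ T (λ t → 𝟙 (t ∈? r ×-dec t ∈? s)) ≤ bichromatic c c′
    ∑-common≤bichromatic {T} {c} {r} {c′} {s} unique (disjoint , meet-once) with c ≟ᵈ c′
    ... | yes c≡c′ = ≤-reflexive (∑𝟙≡0 T (λ t → t ∈? r ×-dec t ∈? s) (disjoint c≡c′))
    ... | no c≢c′  = ∑𝟙≤1 (λ t → t ∈? r ×-dec t ∈? s) unique (meet-once c≢c′)

    coloured-family-bound :
      {B : Set} (members : B → List A) (colour : B → Dir) {κ : ℕ} (T : List A) → Unique T →
      (Ds : List B) →
      All (λ d → Unique (members d) × All (_∈ T) (members d) × length (members d) ≡ κ) Ds →
      AllPairs (λ d e → ColourSeparated (colour d) (members d) (colour e) (members e)) Ds →
      κ * length Ds ∸ (length Ds * length Ds) / 3 ≤ length T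
    coloured-family-bound members colour {κ} T unique Ds sizes separated =
      m≤n+o⇒m∸n≤o (κ * length Ds) ((length Ds * length Ds) / 3) (begin
      κ * length Ds
        ≡⟨ trans (*-comm κ (length Ds)) (sym (∑-const Ds κ)) ⟩
      ∑ Ds (λ _ → κ)
        ≤⟨ ∑-mono-≤ Ds (All.map (λ {d} (u , sub , len) →
             subst (_≤ ∑ T (λ t → 𝟙 (t ∈? members d))) len (length≤∑𝟙∈ u sub)) sizes) ⟩
      ∑ Ds (λ d → ∑ T (λ t → 𝟙 (t ∈? members d)))
        ≡⟨ ∑-comm Ds T _ ⟩
      ∑ T (λ t → ∑ Ds (λ d → 𝟙 (t ∈? members d)))
        ≤⟨ ∑-mono-≤ T (All.tabulate (λ {t} _ → ∑𝟙≤1+∑-pairs𝟙 Ds (λ d → t ∈? members d))) ⟩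
      ∑ T (λ t → 1 + ∑-pairs Ds (λ d e → 𝟙 (t ∈? members d ×-dec t ∈? members e)))
        ≡⟨ ∑-+ T (λ _ → 1) _ ⟩
      ∑ T (λ _ → 1) + ∑ T (λ t → ∑-pairs Ds (λ d e → 𝟙 (t ∈? members d ×-dec t ∈? members e)))
        ≡⟨ cong₂ _+_ (trans (∑-const T 1) (*-identityʳ _)) (∑-∑-pairs-comm T Ds _) ⟩
      length T + ∑-pairs Ds (λ d e → ∑ T (λ t → 𝟙 (t ∈? members d ×-dec t ∈? members e)))
        ≤⟨ +-monoʳ-≤ (length T) (∑-pairs-mono-≤ (AllPairs.map (∑-common≤bichromatic unique) separated)) ⟩
      length T + ∑-pairs Ds (λ d e → bichromatic (colour d) (colour e))
        ≤⟨ +-monoʳ-≤ (length T) (∑-pairs-bichromatic≤ colour Ds) ⟩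
      length T + (length Ds * length Ds) / 3
        ≡⟨ +-comm (length T) _ ⟩
      (length Ds * length Ds) / 3 + length T ∎)
      where open ≤-Reasoning

open Counting

open import Data.Integer as ℤ using (ℤ; _+_; _-_; 0ℤ; 1ℤ; -1ℤ; +≤+; -≤+; +<+; -<+)
import Data.Integer.Properties as ℤₚ
open import Data.Integer.Tactic.RingSolver using (solve-∀)

_≟ᵉ_ : DecidableEquality Edge
edge p c ≟ᵉ edge q c′ =
  map′ (λ (p≡q , c≡c′) → cong₂ edge p≡q c≡c′) (λ e≡f → cong start e≡f , cong dir e≡f)
       (≡-dec ℤ._≟_ ℤ._≟_ p q ×-dec c ≟ᵈ c′)

_≟ᵗ_ : DecidableEquality Tile
tile e ≟ᵗ tile f = map′ (cong tile) (cong diagonal) (e ≟ᵉ f)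

i-1+1≡i : ∀ i → i - 1ℤ + 1ℤ ≡ i
i-1+1≡i = solve-∀

i+1-1≡i : ∀ i → i + 1ℤ - 1ℤ ≡ i
i+1-1≡i = solve-∀

i≡i+0 : ∀ i → i ≡ i + 0ℤ
i≡i+0 i = sym (ℤₚ.+-identityʳ i)

diagDir : Tile → Dir
diagDir t = dir (diagonal t)

base : Tile → Point
base t = start (diagonal t)

-- A tile t has two sides parallel to each direction c ≢ diagDir t: t lies just above its low
-- side and just below its high side (see triAbove-lowSide and triBelow-highSide).  For
-- c ≡ diagDir t the values are junk.
lowPoint highPoint : Dir → Tile → Point
lowPoint d0 (tile (edge (a , b) d0)) = (a , b)
lowPoint d1 (tile (edge (a , b) d0)) = (a , b)
lowPoint d2 (tile (edge (a , b) d0)) = (a + 1ℤ , b - 1ℤ)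
lowPoint d0 (tile (edge (a , b) d1)) = (a , b)
lowPoint d1 (tile (edge (a , b) d1)) = (a , b)
lowPoint d2 (tile (edge (a , b) d1)) = (a - 1ℤ + 1ℤ , b)
lowPoint d0 (tile (edge (a , b) d2)) = (a - 1ℤ , b)
lowPoint d1 (tile (edge (a , b) d2)) = (a - 1ℤ , b)
lowPoint d2 (tile (edge (a , b) d2)) = (a , b)
highPoint d0 (tile (edge (a , b) d0)) = (a , b)
highPoint d1 (tile (edge (a , b) d0)) = (a + 1ℤ , b - 1ℤ)
highPoint d2 (tile (edge (a , b) d0)) = (a + 1ℤ , b)
highPoint d0 (tile (edge (a , b) d1)) = (a - 1ℤ , b + 1ℤ)
highPoint d1 (tile (edge (a , b) d1)) = (a , b)
highPoint d2 (tile (edge (a , b) d1)) = (a + 1ℤ , b)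
highPoint d0 (tile (edge (a , b) d2)) = (a - 1ℤ , b + 1ℤ)
highPoint d1 (tile (edge (a , b) d2)) = (a - 1ℤ + 1ℤ , b)
highPoint d2 (tile (edge (a , b) d2)) = (a , b)

lowSide highSide : Dir → Tile → Edge
lowSide  c t = edge (lowPoint c t) c
highSide c t = edge (highPoint c t) c

Side⇒lowSide⊎highSide : ∀ t e → Side t e →
  diagDir t ≢ dir e × (e ≡ lowSide (dir e) t ⊎ e ≡ highSide (dir e) t)
Side⇒lowSide⊎highSide (tile (edge (a , b) d0)) _ ((_ , inj₁ refl , inj₁ refl) , e≢diag) = ⊥-elim (e≢diag refl)
Side⇒lowSide⊎highSide (tile (edge (a , b) d0)) _ ((_ , inj₁ refl , inj₂ (inj₁ refl)) , _) = (λ ()) , inj₁ refl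
Side⇒lowSide⊎highSide (tile (edge (a , b) d0)) _ ((_ , inj₁ refl , inj₂ (inj₂ refl)) , _) = (λ ()) , inj₂ refl
Side⇒lowSide⊎highSide (tile (edge (a , b) d0)) _ ((_ , inj₂ refl , inj₁ refl) , e≢diag) =
  ⊥-elim (e≢diag (cong (λ z → edge (a , z) d0) (i-1+1≡i b)))
Side⇒lowSide⊎highSide (tile (edge (a , b) d0)) _ ((_ , inj₂ refl , inj₂ (inj₁ refl)) , _) = (λ ()) , inj₂ refl
Side⇒lowSide⊎highSide (tile (edge (a , b) d0)) _ ((_ , inj₂ refl , inj₂ (inj₂ refl)) , _) = (λ ()) , inj₁ refl
Side⇒lowSide⊎highSide (tile (edge (a , b) d1)) _ ((_ , inj₁ refl , inj₁ refl) , _) = (λ ()) , inj₁ refl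
Side⇒lowSide⊎highSide (tile (edge (a , b) d1)) _ ((_ , inj₁ refl , inj₂ (inj₁ refl)) , e≢diag) = ⊥-elim (e≢diag refl)
Side⇒lowSide⊎highSide (tile (edge (a , b) d1)) _ ((_ , inj₁ refl , inj₂ (inj₂ refl)) , _) = (λ ()) , inj₂ refl
Side⇒lowSide⊎highSide (tile (edge (a , b) d1)) _ ((_ , inj₂ refl , inj₁ refl) , _) = (λ ()) , inj₂ refl
Side⇒lowSide⊎highSide (tile (edge (a , b) d1)) _ ((_ , inj₂ refl , inj₂ (inj₁ refl)) , e≢diag) =
  ⊥-elim (e≢diag (cong (λ z → edge (z , b) d1) (i-1+1≡i a)))
Side⇒lowSide⊎highSide (tile (edge (a , b) d1)) _ ((_ , inj₂ refl , inj₂ (inj₂ refl)) , _) = (λ ()) , inj₁ refl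
Side⇒lowSide⊎highSide (tile (edge (a , b) d2)) _ ((_ , inj₁ refl , inj₁ refl) , _) = (λ ()) , inj₁ refl
Side⇒lowSide⊎highSide (tile (edge (a , b) d2)) _ ((_ , inj₁ refl , inj₂ (inj₁ refl)) , _) = (λ ()) , inj₁ refl
Side⇒lowSide⊎highSide (tile (edge (a , b) d2)) _ ((_ , inj₁ refl , inj₂ (inj₂ refl)) , e≢diag) =
  ⊥-elim (e≢diag (cong (λ z → edge (z , b) d2) (i-1+1≡i a)))
Side⇒lowSide⊎highSide (tile (edge (a , b) d2)) _ ((_ , inj₂ refl , inj₁ refl) , _) = (λ ()) , inj₂ refl
Side⇒lowSide⊎highSide (tile (edge (a , b) d2)) _ ((_ , inj₂ refl , inj₂ (inj₁ refl)) , _) = (λ ()) , inj₂ refl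
Side⇒lowSide⊎highSide (tile (edge (a , b) d2)) _ ((_ , inj₂ refl , inj₂ (inj₂ refl)) , e≢diag) =
  ⊥-elim (e≢diag (cong (λ z → edge (z , b) d2) (i-1+1≡i a)))

lowSide-Side : ∀ c t → diagDir t ≢ c → Side t (lowSide c t)
lowSide-Side d0 (tile (edge (a , b) d0)) c≢c = ⊥-elim (c≢c refl)
lowSide-Side d1 (tile (edge (a , b) d0)) _   = (_ , inj₁ refl , inj₂ (inj₁ refl)) , (λ ())
lowSide-Side d2 (tile (edge (a , b) d0)) _   = (_ , inj₂ refl , inj₂ (inj₂ refl)) , (λ ())
lowSide-Side d0 (tile (edge (a , b) d1)) _   = (_ , inj₁ refl , inj₁ refl) , (λ ())
lowSide-Side d1 (tile (edge (a , b) d1)) c≢c = ⊥-elim (c≢c refl)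
lowSide-Side d2 (tile (edge (a , b) d1)) _   = (_ , inj₂ refl , inj₂ (inj₂ refl)) , (λ ())
lowSide-Side d0 (tile (edge (a , b) d2)) _   = (_ , inj₁ refl , inj₁ refl) , (λ ())
lowSide-Side d1 (tile (edge (a , b) d2)) _   = (_ , inj₁ refl , inj₂ (inj₁ refl)) , (λ ())
lowSide-Side d2 (tile (edge (a , b) d2)) c≢c = ⊥-elim (c≢c refl)

highSide-Side : ∀ c t → diagDir t ≢ c → Side t (highSide c t)
highSide-Side d0 (tile (edge (a , b) d0)) c≢c = ⊥-elim (c≢c refl)
highSide-Side d1 (tile (edge (a , b) d0)) _   = (_ , inj₂ refl , inj₂ (inj₁ refl)) , (λ ())
highSide-Side d2 (tile (edge (a , b) d0)) _   = (_ , inj₁ refl , inj₂ (inj₂ refl)) , (λ ())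
highSide-Side d0 (tile (edge (a , b) d1)) _   = (_ , inj₂ refl , inj₁ refl) , (λ ())
highSide-Side d1 (tile (edge (a , b) d1)) c≢c = ⊥-elim (c≢c refl)
highSide-Side d2 (tile (edge (a , b) d1)) _   = (_ , inj₁ refl , inj₂ (inj₂ refl)) , (λ ())
highSide-Side d0 (tile (edge (a , b) d2)) _   = (_ , inj₂ refl , inj₁ refl) , (λ ())
highSide-Side d1 (tile (edge (a , b) d2)) _   = (_ , inj₂ refl , inj₂ (inj₁ refl)) , (λ ())
highSide-Side d2 (tile (edge (a , b) d2)) c≢c = ⊥-elim (c≢c refl)

triAbove triBelow : Edge → Tri
triAbove (edge p d0)       = tri p up
triAbove (edge p d1)       = tri p up
triAbove (edge (a , b) d2) = tri (a - 1ℤ , b) down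
triBelow (edge (a , b) d0) = tri (a , b - 1ℤ) down
triBelow (edge (a , b) d1) = tri (a - 1ℤ , b) down
triBelow (edge (a , b) d2) = tri (a - 1ℤ , b) up

triAbove-lowSide : ∀ c t → diagDir t ≢ c → TileTri t (triAbove (lowSide c t))
triAbove-lowSide d0 (tile (edge (a , b) d0)) c≢c = ⊥-elim (c≢c refl)
triAbove-lowSide d1 (tile (edge (a , b) d0)) _   = inj₁ refl
triAbove-lowSide d2 (tile (edge (a , b) d0)) _   = inj₂ (cong (λ z → tri (z , b - 1ℤ) down) (i+1-1≡i a))
triAbove-lowSide d0 (tile (edge (a , b) d1)) _   = inj₁ refl
triAbove-lowSide d1 (tile (edge (a , b) d1)) c≢c = ⊥-elim (c≢c refl)
triAbove-lowSide d2 (tile (edge (a , b) d1)) _   = inj₂ (cong (λ z → tri (z , b) down) (i+1-1≡i (a - 1ℤ)))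
triAbove-lowSide d0 (tile (edge (a , b) d2)) _   = inj₁ refl
triAbove-lowSide d1 (tile (edge (a , b) d2)) _   = inj₁ refl
triAbove-lowSide d2 (tile (edge (a , b) d2)) c≢c = ⊥-elim (c≢c refl)

triBelow-highSide : ∀ c t → diagDir t ≢ c → TileTri t (triBelow (highSide c t))
triBelow-highSide d0 (tile (edge (a , b) d0)) c≢c = ⊥-elim (c≢c refl)
triBelow-highSide d1 (tile (edge (a , b) d0)) _   = inj₂ (cong (λ z → tri (z , b - 1ℤ) down) (i+1-1≡i a))
triBelow-highSide d2 (tile (edge (a , b) d0)) _   = inj₁ (cong (λ z → tri (z , b) up) (i+1-1≡i a))
triBelow-highSide d0 (tile (edge (a , b) d1)) _   = inj₂ (cong (λ z → tri (a - 1ℤ , z) down) (i+1-1≡i b))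
triBelow-highSide d1 (tile (edge (a , b) d1)) c≢c = ⊥-elim (c≢c refl)
triBelow-highSide d2 (tile (edge (a , b) d1)) _   = inj₁ (cong (λ z → tri (z , b) up) (i+1-1≡i a))
triBelow-highSide d0 (tile (edge (a , b) d2)) _   = inj₂ (cong (λ z → tri (a - 1ℤ , z) down) (i+1-1≡i b))
triBelow-highSide d1 (tile (edge (a , b) d2)) _   = inj₂ (cong (λ z → tri (z , b) down) (i+1-1≡i (a - 1ℤ)))
triBelow-highSide d2 (tile (edge (a , b) d2)) c≢c = ⊥-elim (c≢c refl)

NoOverlap : List Tile → Set
NoOverlap T = ∀ {t u x} → t ∈ T → u ∈ T → TileTri t x → TileTri u x → t ≡ u

vertex : Tri → Point
vertex (tri (a , b) up)   = (a , b)
vertex (tri (a , b) down) = (a + 1ℤ , b)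

TriVertex-vertex : ∀ x → TriVertex x (vertex x)
TriVertex-vertex (tri _ up)   = inj₁ refl
TriVertex-vertex (tri _ down) = inj₁ refl

GoodPair⇒NoCommonTri : ∀ {t u} → GoodPair t u → NoCommonTri t u
GoodPair⇒NoCommonTri (inj₁ disjoint) x t∋x u∋x =
  disjoint (vertex x , (x , t∋x , TriVertex-vertex x) , (x , u∋x , TriVertex-vertex x))
GoodPair⇒NoCommonTri (inj₂ (inj₁ (no-common-tri , _))) = no-common-tri
GoodPair⇒NoCommonTri (inj₂ (inj₂ (no-common-tri , _))) = no-common-tri

P2⇒NoOverlap : ∀ {T} → (∀ t u → t ∈ T → u ∈ T → t ≢ u → GoodPair t u) → NoOverlap T
P2⇒NoOverlap good {t} {u} {x} t∈T u∈T t∋x u∋x with t ≟ᵗ u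
... | yes t≡u = t≡u
... | no t≢u  = ⊥-elim (GoodPair⇒NoCommonTri (good t u t∈T u∈T t≢u) x t∋x u∋x)

module _ {T : List Tile} (noOverlap : NoOverlap T) {c : Dir} {t u : Tile}
         (t∈T : t ∈ T) (u∈T : u ∈ T) (t≢c : diagDir t ≢ c) (u≢c : diagDir u ≢ c) where

  lowSide-injective : lowSide c t ≡ lowSide c u → t ≡ u
  lowSide-injective eq = noOverlap t∈T u∈T (triAbove-lowSide c t t≢c)
    (subst (TileTri u ∘ triAbove) (sym eq) (triAbove-lowSide c u u≢c))

  highSide-injective : highSide c t ≡ highSide c u → t ≡ u
  highSide-injective eq = noOverlap t∈T u∈T (triBelow-highSide c t t≢c)
    (subst (TileTri u ∘ triBelow) (sym eq) (triBelow-highSide c u u≢c))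

data Orientation : Set where
  ascending descending : Orientation

reverseᵒ : Orientation → Orientation
reverseᵒ ascending  = descending
reverseᵒ descending = ascending

entrySide exitSide : Orientation → Dir → Tile → Edge
entrySide ascending  = lowSide
entrySide descending = highSide
exitSide  ascending  = highSide
exitSide  descending = lowSide

Step : Orientation → Dir → Tile → Tile → Set
Step o c t u = exitSide o c t ≡ entrySide o c u × diagDir t ≢ c × diagDir u ≢ c

Ascending : Dir → List Tile → Set
Ascending c = Linked (Step ascending c)

Step-reverse : ∀ o {c t u} → Step o c t u → Step (reverseᵒ o) c u t
Step-reverse ascending  (eq , t≢c , u≢c) = sym eq , u≢c , t≢c
Step-reverse descending (eq , t≢c , u≢c) = sym eq , u≢c , t≢c

Side⇒entrySide⊎exitSide : ∀ o {c} t e → Side t e → dir e ≡ c →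
  diagDir t ≢ c × (e ≡ entrySide o c t ⊎ e ≡ exitSide o c t)
Side⇒entrySide⊎exitSide ascending  t e side refl = Side⇒lowSide⊎highSide t e side
Side⇒entrySide⊎exitSide descending t e side refl with Side⇒lowSide⊎highSide t e side
... | t≢c , inj₁ low  = t≢c , inj₂ low
... | t≢c , inj₂ high = t≢c , inj₁ high

entrySide-Side : ∀ o c t → diagDir t ≢ c → Side t (entrySide o c t)
entrySide-Side ascending  = lowSide-Side
entrySide-Side descending = highSide-Side

exitSide-Side : ∀ o c t → diagDir t ≢ c → Side t (exitSide o c t)
exitSide-Side ascending  = highSide-Side
exitSide-Side descending = lowSide-Side

dir-entrySide : ∀ o c t → dir (entrySide o c t) ≡ c
dir-entrySide ascending  c t = refl
dir-entrySide descending c t = refl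

dir-exitSide : ∀ o c t → dir (exitSide o c t) ≡ c
dir-exitSide ascending  c t = refl
dir-exitSide descending c t = refl

exitSide-injective : ∀ {T} → NoOverlap T → ∀ o {c t u} → t ∈ T → u ∈ T →
  diagDir t ≢ c → diagDir u ≢ c → exitSide o c t ≡ exitSide o c u → t ≡ u
exitSide-injective noOverlap ascending  = highSide-injective noOverlap
exitSide-injective noOverlap descending = lowSide-injective noOverlap

Functional : Set
Functional = ℤ × ℤ

φ : Functional → Point → ℤ
φ (α , β) (x , y) = α ℤ.* x + β ℤ.* y

φ-⊕ : ∀ w p q → φ w (p ⊕ q) ≡ φ w p + φ w q
φ-⊕ (α , β) (a , b) (c , d) = distrib α β a b c d
  where
  distrib : ∀ α β a b c d → α ℤ.* (a + c) + β ℤ.* (b + d) ≡ (α ℤ.* a + β ℤ.* b) + (α ℤ.* c + β ℤ.* d)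
  distrib = solve-∀

offset stride : Dir → Dir → Point
offset d2 d0 = (1ℤ , -1ℤ)
offset d0 d2 = (-1ℤ , 0ℤ)
offset d1 d2 = (-1ℤ , 0ℤ)
offset _  _  = (0ℤ , 0ℤ)
stride d0 d1 = (-1ℤ , 1ℤ)
stride d0 d2 = (0ℤ , 1ℤ)
stride d1 d0 = (1ℤ , -1ℤ)
stride d1 d2 = (1ℤ , 0ℤ)
stride d2 d0 = (0ℤ , 1ℤ)
stride d2 d1 = (1ℤ , 0ℤ)
stride _  _  = (0ℤ , 0ℤ)

lowPoint≡base⊕offset : ∀ c t → lowPoint c t ≡ base t ⊕ offset c (diagDir t)
lowPoint≡base⊕offset d0 (tile (edge (a , b) d0)) = cong₂ _,_ (i≡i+0 a) (i≡i+0 b)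
lowPoint≡base⊕offset d1 (tile (edge (a , b) d0)) = cong₂ _,_ (i≡i+0 a) (i≡i+0 b)
lowPoint≡base⊕offset d2 (tile (edge (a , b) d0)) = refl
lowPoint≡base⊕offset d0 (tile (edge (a , b) d1)) = cong₂ _,_ (i≡i+0 a) (i≡i+0 b)
lowPoint≡base⊕offset d1 (tile (edge (a , b) d1)) = cong₂ _,_ (i≡i+0 a) (i≡i+0 b)
lowPoint≡base⊕offset d2 (tile (edge (a , b) d1)) = cong₂ _,_ (trans (i-1+1≡i a) (i≡i+0 a)) (i≡i+0 b)
lowPoint≡base⊕offset d0 (tile (edge (a , b) d2)) = cong₂ _,_ refl (i≡i+0 b)
lowPoint≡base⊕offset d1 (tile (edge (a , b) d2)) = cong₂ _,_ refl (i≡i+0 b)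
lowPoint≡base⊕offset d2 (tile (edge (a , b) d2)) = cong₂ _,_ (i≡i+0 a) (i≡i+0 b)

highPoint≡lowPoint⊕stride : ∀ c t → highPoint c t ≡ lowPoint c t ⊕ stride c (diagDir t)
highPoint≡lowPoint⊕stride d0 (tile (edge (a , b) d0)) = cong₂ _,_ (i≡i+0 a) (i≡i+0 b)
highPoint≡lowPoint⊕stride d1 (tile (edge (a , b) d0)) = refl
highPoint≡lowPoint⊕stride d2 (tile (edge (a , b) d0)) = cong₂ _,_ (i≡i+0 (a + 1ℤ)) (sym (i-1+1≡i b))
highPoint≡lowPoint⊕stride d0 (tile (edge (a , b) d1)) = refl
highPoint≡lowPoint⊕stride d1 (tile (edge (a , b) d1)) = cong₂ _,_ (i≡i+0 a) (i≡i+0 b)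
highPoint≡lowPoint⊕stride d2 (tile (edge (a , b) d1)) = cong₂ _,_ (cong (_+ 1ℤ) (sym (i-1+1≡i a))) (i≡i+0 b)
highPoint≡lowPoint⊕stride d0 (tile (edge (a , b) d2)) = cong₂ _,_ (i≡i+0 (a - 1ℤ)) refl
highPoint≡lowPoint⊕stride d1 (tile (edge (a , b) d2)) = cong₂ _,_ refl (i≡i+0 b)
highPoint≡lowPoint⊕stride d2 (tile (edge (a , b) d2)) = cong₂ _,_ (i≡i+0 a) (i≡i+0 b)

φ-lowPoint : ∀ w c t → φ w (lowPoint c t) ≡ φ w (base t) + φ w (offset c (diagDir t))
φ-lowPoint w c t = trans (cong (φ w) (lowPoint≡base⊕offset c t)) (φ-⊕ w _ _)

φ-highPoint : ∀ w c t → φ w (highPoint c t) ≡ φ w (lowPoint c t) + φ w (stride c (diagDir t))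
φ-highPoint w c t = trans (cong (φ w) (highPoint≡lowPoint⊕stride c t)) (φ-⊕ w _ _)

+-cancelˡ-≤ᶻ : ∀ k {i j} → k + i ℤ.≤ k + j → i ℤ.≤ j
+-cancelˡ-≤ᶻ k {i} {j} le = subst₂ ℤ._≤_ (cancel k i) (cancel k j) (ℤₚ.+-monoʳ-≤ (ℤ.- k) le)
  where
  cancel : ∀ k i → ℤ.- k + (k + i) ≡ i
  cancel = solve-∀

0≤j⇒i≤i+j : ∀ {i j} → 0ℤ ℤ.≤ j → i ℤ.≤ i + j
0≤j⇒i≤i+j {i} 0≤j = subst (ℤ._≤ i + _) (ℤₚ.+-identityʳ i) (ℤₚ.+-monoʳ-≤ i 0≤j)

j≤0⇒i+j≤i : ∀ {i j} → j ℤ.≤ 0ℤ → i + j ℤ.≤ i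
j≤0⇒i+j≤i {i} j≤0 = subst (i + _ ℤ.≤_) (ℤₚ.+-identityʳ i) (ℤₚ.+-monoʳ-≤ i j≤0)

+-≤-sandwich : ∀ {x y s s′} → x + s ℤ.≤ y → y ℤ.≤ x + s′ → s ℤ.≤ s′
+-≤-sandwich {x} lower upper = +-cancelˡ-≤ᶻ x (ℤₚ.≤-trans lower upper)

+-≤-cycle : ∀ {x y s s′} → x + s ℤ.≤ y → y + s′ ℤ.≤ x → s + s′ ℤ.≤ 0ℤ
+-≤-cycle {x} {y} {s} {s′} forth back = +-cancelˡ-≤ᶻ x (begin
  x + (s + s′) ≡⟨ ℤₚ.+-assoc x s s′ ⟨
  x + s + s′   ≤⟨ ℤₚ.+-monoˡ-≤ s′ forth ⟩
  y + s′       ≤⟨ back ⟩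
  x            ≡⟨ ℤₚ.+-identityʳ x ⟨
  x + 0ℤ       ∎)
  where open ℤₚ.≤-Reasoning

Path : Dir → Tile → Tile → Set
Path c = TransClosure (Step ascending c)

Path-source≢ : ∀ {c t v} → Path c t v → diagDir t ≢ c
Path-source≢ [ _ , t≢c , _ ] = t≢c
Path-source≢ ((_ , t≢c , _) ∷ _) = t≢c

Path-target≢ : ∀ {c t v} → Path c t v → diagDir v ≢ c
Path-target≢ [ _ , _ , v≢c ] = v≢c
Path-target≢ (_ ∷ path) = Path-target≢ path

φ-Step : ∀ w {c t u} → Step ascending c t u →
         φ w (lowPoint c u) ≡ φ w (lowPoint c t) + φ w (stride c (diagDir t))
φ-Step w {c} {t} (high≡low , _) = trans (cong (φ w ∘ start) (sym high≡low)) (φ-highPoint w c t)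

Monotone Antitone : Functional → Dir → Set
Monotone w c = ∀ d → 0ℤ ℤ.≤ φ w (stride c d)
Antitone w c = ∀ d → φ w (stride c d) ℤ.≤ 0ℤ

module _ (w : Functional) {c : Dir} where

  Path-increasing : Monotone w c → ∀ {t v} → Path c t v →
    φ w (lowPoint c t) + φ w (stride c (diagDir t)) ℤ.≤ φ w (lowPoint c v)
  Path-increasing mono [ next ] = ℤₚ.≤-reflexive (sym (φ-Step w next))
  Path-increasing mono {t} {v} (_∷_ {y = u} next path) = begin
    φ w (lowPoint c t) + φ w (stride c (diagDir t)) ≡⟨ φ-Step w next ⟨
    φ w (lowPoint c u)                              ≤⟨ 0≤j⇒i≤i+j (mono (diagDir u)) ⟩
    φ w (lowPoint c u) + φ w (stride c (diagDir u)) ≤⟨ Path-increasing mono path ⟩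
    φ w (lowPoint c v)                              ∎
    where open ℤₚ.≤-Reasoning

  Path-decreasing : Antitone w c → ∀ {t v} → Path c t v →
    φ w (lowPoint c v) ℤ.≤ φ w (lowPoint c t) + φ w (stride c (diagDir t))
  Path-decreasing anti [ next ] = ℤₚ.≤-reflexive (φ-Step w next)
  Path-decreasing anti {t} {v} (_∷_ {y = u} next path) = begin
    φ w (lowPoint c v)                              ≤⟨ Path-decreasing anti path ⟩
    φ w (lowPoint c u) + φ w (stride c (diagDir u)) ≤⟨ j≤0⇒i+j≤i (anti (diagDir u)) ⟩
    φ w (lowPoint c u)                              ≡⟨ φ-Step w next ⟩
    φ w (lowPoint c t) + φ w (stride c (diagDir t)) ∎
    where open ℤₚ.≤-Reasoning

  -- Between tiles with the same diagonal direction d the offsets cancel.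
  module _ {d t v} (t-d : diagDir t ≡ d) (v-d : diagDir v ≡ d) where

    private
      o = φ w (offset c d)

      φ-lowPoint′ : ∀ {u} → diagDir u ≡ d → φ w (lowPoint c u) ≡ o + φ w (base u)
      φ-lowPoint′ {u} refl = trans (φ-lowPoint w c u) (ℤₚ.+-comm _ o)

    Path-increasing-base : Monotone w c → Path c t v →
      φ w (base t) + φ w (stride c d) ℤ.≤ φ w (base v)
    Path-increasing-base mono path = +-cancelˡ-≤ᶻ o (begin
      o + (φ w (base t) + φ w (stride c d)) ≡⟨ ℤₚ.+-assoc o _ _ ⟨
      o + φ w (base t) + φ w (stride c d)   ≡⟨ cong₂ _+_ (φ-lowPoint′ t-d) (cong (φ w ∘ stride c) t-d) ⟨
      φ w (lowPoint c t) + φ w (stride c (diagDir t)) ≤⟨ Path-increasing mono path ⟩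
      φ w (lowPoint c v)                    ≡⟨ φ-lowPoint′ v-d ⟩
      o + φ w (base v)                      ∎)
      where open ℤₚ.≤-Reasoning

    Path-decreasing-base : Antitone w c → Path c t v →
      φ w (base v) ℤ.≤ φ w (base t) + φ w (stride c d)
    Path-decreasing-base anti path = +-cancelˡ-≤ᶻ o (begin
      o + φ w (base v)                      ≡⟨ φ-lowPoint′ v-d ⟨
      φ w (lowPoint c v)                    ≤⟨ Path-decreasing anti path ⟩
      φ w (lowPoint c t) + φ w (stride c (diagDir t)) ≡⟨ cong₂ _+_ (φ-lowPoint′ t-d) (cong (φ w ∘ stride c) t-d) ⟩
      o + φ w (base t) + φ w (stride c d)   ≡⟨ ℤₚ.+-assoc o _ _ ⟩
      o + (φ w (base t) + φ w (stride c d)) ∎)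
      where open ℤₚ.≤-Reasoning

Third : Dir → Dir → Dir → Set
Third c c′ d = ∀ {x} → x ≢ c → x ≢ c′ → x ≡ d

third₂ : Third d0 d1 d2
third₂ {d0} x≢d0 _ = ⊥-elim (x≢d0 refl)
third₂ {d1} _ x≢d1 = ⊥-elim (x≢d1 refl)
third₂ {d2} _ _    = refl

third₁ : Third d0 d2 d1
third₁ {d0} x≢d0 _ = ⊥-elim (x≢d0 refl)
third₁ {d1} _ _    = refl
third₁ {d2} _ x≢d2 = ⊥-elim (x≢d2 refl)

third₀ : Third d1 d2 d0
third₀ {d0} _ _    = refl
third₀ {d1} x≢d1 _ = ⊥-elim (x≢d1 refl)
third₀ {d2} _ x≢d2 = ⊥-elim (x≢d2 refl)

-- A tile on tracks of two classes c and c′ has the third direction d as diagonal direction,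
-- so two such tiles can be compared through the functional at their base points.
module _ (w : Functional) {c c′ d : Dir} (third : Third c c′ d) where

  parallel-crossing-impossible : Antitone w c → Monotone w c′ →
    φ w (stride c d) ℤ.< φ w (stride c′ d) → ∀ {t v} → Path c t v → Path c′ t v → ⊥
  parallel-crossing-impossible anti mono gap {t} p q = ℤₚ.<⇒≱ gap (+-≤-sandwich {φ w (base t)}
      (Path-increasing-base w t-d v-d mono q) (Path-decreasing-base w t-d v-d anti p))
    where
    t-d = third (Path-source≢ p) (Path-source≢ q)
    v-d = third (Path-target≢ p) (Path-target≢ q)

  opposite-crossing-impossible : Monotone w c → Monotone w c′ →
    0ℤ ℤ.< φ w (stride c d) + φ w (stride c′ d) → ∀ {t v} → Path c t v → Path c′ v t → ⊥
  opposite-crossing-impossible mono mono′ gap {t} p q = ℤₚ.<⇒≱ gap (+-≤-cycle {φ w (base t)}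
      (Path-increasing-base w t-d v-d mono p) (Path-increasing-base w v-d t-d mono′ q))
    where
    t-d = third (Path-source≢ p) (Path-target≢ q)
    v-d = third (Path-target≢ p) (Path-source≢ q)

0≤0 : 0ℤ ℤ.≤ 0ℤ
0≤0 = +≤+ z≤n

0≤1 : 0ℤ ℤ.≤ 1ℤ
0≤1 = +≤+ z≤n

-1≤0 : -1ℤ ℤ.≤ 0ℤ
-1≤0 = -≤+

0<1 : 0ℤ ℤ.< 1ℤ
0<1 = +<+ (s≤s z≤n)

0<2 : 0ℤ ℤ.< 1ℤ + 1ℤ
0<2 = +<+ (s≤s z≤n)

-1<1 : -1ℤ ℤ.< 1ℤ
-1<1 = -<+

crossing-impossible : ∀ c c′ {t v} → c ≢ c′ → Path c t v → Path c′ t v ⊎ Path c′ v t → ⊥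
crossing-impossible d0 d0 c≢c _ _ = c≢c refl
crossing-impossible d1 d1 c≢c _ _ = c≢c refl
crossing-impossible d2 d2 c≢c _ _ = c≢c refl
crossing-impossible d0 d1 _ p (inj₁ q) = parallel-crossing-impossible (1ℤ , 0ℤ) third₂
  (everywhere 0≤0 -1≤0 0≤0) (everywhere 0≤1 0≤0 0≤1) 0<1 p q
crossing-impossible d0 d2 _ p (inj₁ q) = parallel-crossing-impossible (1ℤ , 0ℤ) third₁
  (everywhere 0≤0 -1≤0 0≤0) (everywhere 0≤0 0≤1 0≤0) -1<1 p q
crossing-impossible d1 d2 _ p (inj₁ q) = parallel-crossing-impossible (0ℤ , 1ℤ) third₀
  (everywhere -1≤0 0≤0 0≤0) (everywhere 0≤1 0≤0 0≤0) -1<1 p q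
crossing-impossible d0 d1 _ p (inj₂ q) = opposite-crossing-impossible (1ℤ , 1ℤ) third₂
  (everywhere 0≤0 0≤0 0≤1) (everywhere 0≤0 0≤0 0≤1) 0<2 p q
crossing-impossible d0 d2 _ p (inj₂ q) = opposite-crossing-impossible (0ℤ , 1ℤ) third₁
  (everywhere 0≤0 0≤1 0≤1) (everywhere 0≤1 0≤0 0≤0) 0<1 p q
crossing-impossible d1 d2 _ p (inj₂ q) = opposite-crossing-impossible (1ℤ , 0ℤ) third₀
  (everywhere 0≤1 0≤0 0≤1) (everywhere 0≤0 0≤1 0≤0) 0<1 p q
crossing-impossible d1 d0 _ p (inj₁ q) = crossing-impossible d0 d1 (λ ()) q (inj₁ p)
crossing-impossible d2 d0 _ p (inj₁ q) = crossing-impossible d0 d2 (λ ()) q (inj₁ p)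
crossing-impossible d2 d1 _ p (inj₁ q) = crossing-impossible d1 d2 (λ ()) q (inj₁ p)
crossing-impossible d1 d0 _ p (inj₂ q) = crossing-impossible d0 d1 (λ ()) q (inj₂ p)
crossing-impossible d2 d0 _ p (inj₂ q) = crossing-impossible d0 d2 (λ ()) q (inj₂ p)
crossing-impossible d2 d1 _ p (inj₂ q) = crossing-impossible d1 d2 (λ ()) q (inj₂ p)

tracks-meet-once : ∀ {c c′ t v} → c ≢ c′ →
  Path c t v ⊎ Path c v t → Path c′ t v ⊎ Path c′ v t → ⊥
tracks-meet-once c≢c′ (inj₁ p) q = crossing-impossible _ _ c≢c′ p q
tracks-meet-once c≢c′ (inj₂ p) q = crossing-impossible _ _ c≢c′ p (swap q)

-- Along a track of class c, φ (height c) grows by exactly one per tile.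
height : Dir → Functional
height d0 = (0ℤ , 1ℤ)
height d1 = (1ℤ , 0ℤ)
height d2 = (1ℤ , 1ℤ)

φ-height-stride : ∀ c {d} → d ≢ c → φ (height c) (stride c d) ≡ 1ℤ
φ-height-stride d0 {d0} d≢c = ⊥-elim (d≢c refl)
φ-height-stride d0 {d1} _   = refl
φ-height-stride d0 {d2} _   = refl
φ-height-stride d1 {d0} _   = refl
φ-height-stride d1 {d1} d≢c = ⊥-elim (d≢c refl)
φ-height-stride d1 {d2} _   = refl
φ-height-stride d2 {d0} _   = refl
φ-height-stride d2 {d1} _   = refl
φ-height-stride d2 {d2} d≢c = ⊥-elim (d≢c refl)

height-monotone : ∀ c → Monotone (height c) c
height-monotone d0 = everywhere 0≤0 0≤1 0≤1
height-monotone d1 = everywhere 0≤1 0≤0 0≤1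
height-monotone d2 = everywhere 0≤1 0≤1 0≤0

i+1≰i : ∀ {i} → ¬ (i + 1ℤ ℤ.≤ i)
i+1≰i {i} i+1≤i with +-cancelˡ-≤ᶻ i (subst (i + 1ℤ ℤ.≤_) (i≡i+0 i) i+1≤i)
... | +≤+ ()

Path-irreflexive : ∀ {c t} → ¬ Path c t t
Path-irreflexive {c} {t} cycle = i+1≰i (subst (λ s → h + s ℤ.≤ h)
  (φ-height-stride c (Path-source≢ cycle)) (Path-increasing (height c) (height-monotone c) cycle))
  where
  h = φ (height c) (lowPoint c t)

lowSide≢highSide : ∀ c t → diagDir t ≢ c → lowSide c t ≢ highSide c t
lowSide≢highSide c t t≢c low≡high = i+1≰i (ℤₚ.≤-reflexive (begin
  φ h (lowPoint c t) + 1ℤ                        ≡⟨ cong (φ h (lowPoint c t) +_) (φ-height-stride c t≢c) ⟨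
  φ h (lowPoint c t) + φ h (stride c (diagDir t)) ≡⟨ φ-highPoint h c t ⟨
  φ h (highPoint c t)                            ≡⟨ cong (φ h ∘ start) low≡high ⟨
  φ h (lowPoint c t)                             ∎))
  where
  open ≡-Reasoning
  h = height c

entrySide≢exitSide : ∀ o c t → diagDir t ≢ c → entrySide o c t ≢ exitSide o c t
entrySide≢exitSide ascending  c t t≢c = lowSide≢highSide c t t≢c
entrySide≢exitSide descending c t t≢c = lowSide≢highSide c t t≢c ∘ sym

Linked⇒ChainAfter : ∀ o {c y l} → Linked (Step o c) (y ∷ l) → ChainAfter y (entrySide o c y) l
Linked⇒ChainAfter o [-] = end
Linked⇒ChainAfter o {c} {y} ((exit≡entry , y≢c , z≢c) ∷ linked) =
  step (entrySide-Side o c y y≢c , exitSide-Side o c y y≢c ,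
        trans (dir-entrySide o c y) (sym (dir-exitSide o c y)) , entrySide≢exitSide o c y y≢c)
       (subst (Side _) (sym exit≡entry) (entrySide-Side o c _ z≢c))
       (subst (λ e → ChainAfter _ e _) (sym exit≡entry) (Linked⇒ChainAfter o linked))

Linked⇒IsChain : ∀ o {c x y l} → Linked (Step o c) (x ∷ y ∷ l) → IsChain (x ∷ y ∷ l)
Linked⇒IsChain o {c} {x} {y} ((exit≡entry , x≢c , y≢c) ∷ linked) =
  chain (exitSide-Side o c x x≢c) (subst (Side y) (sym exit≡entry) (entrySide-Side o c y y≢c))
        (subst (λ e → ChainAfter y e _) (sym exit≡entry) (Linked⇒ChainAfter o linked))

Linked⇒AllPairs-Path : ∀ {c l} → Ascending c l → AllPairs (Path c) l
Linked⇒AllPairs-Path = Linked⇒AllPairs (transitive _) ∘ Linked.map TransClosure.[_]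

Linked-head∉ : ∀ {c u l} → Ascending c (u ∷ l) → ¬ u ∈ l
Linked-head∉ linked u∈l = Path-irreflexive (All.lookup (AllPairs.head (Linked⇒AllPairs-Path linked)) u∈l)

predecessor : ∀ {c y ys z} → Ascending c (y ∷ ys) → z ∈ ys →
              ∃[ v ] (v ∈ y ∷ ys × Step ascending c v z)
predecessor {y = y} (next ∷ _)      (here refl) = y , here refl , next
predecessor         (_    ∷ linked) (there z∈)  with predecessor linked z∈
... | v , v∈ , next = v , there v∈ , next

Initial : List Tile → Dir → List Tile → Set
Initial T c l = ∀ {u} → u ∈ T → ¬ Ascending c (u ∷ l)

module _ {T : List Tile} (noOverlap : NoOverlap T) where

  ChainAfter⇒Linked : ∀ o {c u e us} → u ∈ T → All (_∈ T) us → Unique (u ∷ us) →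
    ChainAfter u e us → e ≡ entrySide o c u → diagDir u ≢ c → Linked (Step o c) (u ∷ us)
  ChainAfter⇒Linked o _ [] _ end _ _ = [-]
  ChainAfter⇒Linked o {c} {u} u∈T (v∈T ∷ vs∈T) ((u≢v ∷ _) ∷ unique)
                    (step {f = f} {u = v} (_ , f-side , e∥f , e≢f) v-side rest) e≡entry u≢c
    with Side⇒entrySide⊎exitSide o u f f-side (f-dir e∥f e≡entry)
       | Side⇒entrySide⊎exitSide o v f v-side (f-dir e∥f e≡entry)
    where
    f-dir : ∀ {e} → Parallel e f → e ≡ entrySide o c u → dir f ≡ c
    f-dir e∥f refl = trans (sym e∥f) (dir-entrySide o c u)
  ... | _ , inj₁ f≡entry | _ = ⊥-elim (e≢f (trans e≡entry (sym f≡entry)))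
  ... | _ , inj₂ f≡exit  | v≢c , inj₁ f≡entry =
    (trans (sym f≡exit) f≡entry , u≢c , v≢c) ∷ ChainAfter⇒Linked o v∈T vs∈T unique rest f≡entry v≢c
  ... | _ , inj₂ f≡exit  | v≢c , inj₂ f≡exit′ =
    ⊥-elim (u≢v (exitSide-injective noOverlap o u∈T v∈T u≢c v≢c (trans (sym f≡exit) f≡exit′)))

  ChainIn⇒Linked : ∀ {r} → ChainIn T r → ∃[ c ] ∃[ o ] Linked (Step o c) r
  ChainIn⇒Linked (chain {t} {u} {e} t-side u-side rest , ((t≢u ∷ _) ∷ unique) , t∈T ∷ u∈T ∷ us∈T)
    with Side⇒lowSide⊎highSide t e t-side | Side⇒lowSide⊎highSide u e u-side
  ... | t≢c , inj₂ high | u≢c , inj₁ low  = dir e , ascending ,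
    (trans (sym high) low , t≢c , u≢c) ∷ ChainAfter⇒Linked ascending u∈T us∈T unique rest low u≢c
  ... | t≢c , inj₁ low  | u≢c , inj₂ high = dir e , descending ,
    (trans (sym low) high , t≢c , u≢c) ∷ ChainAfter⇒Linked descending u∈T us∈T unique rest high u≢c
  ... | t≢c , inj₁ low  | u≢c , inj₁ low′  =
    ⊥-elim (t≢u (lowSide-injective noOverlap t∈T u∈T t≢c u≢c (trans (sym low) low′)))
  ... | t≢c , inj₂ high | u≢c , inj₂ high′ =
    ⊥-elim (t≢u (highSide-injective noOverlap t∈T u∈T t≢c u≢c (trans (sym high) high′)))

  Step-predecessor-unique : ∀ {c v x z} → v ∈ T → x ∈ T →
    Step ascending c v z → Step ascending c x z → v ≡ x
  Step-predecessor-unique v∈T x∈T (v→z , v≢c , _) (x→z , x≢c , _) =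
    highSide-injective noOverlap v∈T x∈T v≢c x≢c (trans v→z (sym x→z))

  Step-successor-unique : ∀ {c x y z} → y ∈ T → z ∈ T →
    Step ascending c x y → Step ascending c x z → y ≡ z
  Step-successor-unique y∈T z∈T (x→y , _ , y≢c) (x→z , _ , z≢c) =
    lowSide-injective noOverlap y∈T z∈T y≢c z≢c (trans (sym x→y) x→z)

  module _ {c : Dir} where

    -- Predecessors being unique, two ascents through a common tile agree below it.
    shared⇒head∈ : ∀ {x xs y ys t} → Ascending c (x ∷ xs) → Ascending c (y ∷ ys) →
      All (_∈ T) (x ∷ xs) → All (_∈ T) (y ∷ ys) → t ∈ x ∷ xs → t ∈ y ∷ ys →
      x ∈ y ∷ ys ⊎ y ∈ x ∷ xs
    shared⇒head∈ _ _ _ _ (here refl) t∈ys = inj₁ t∈ys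
    shared⇒head∈ _ _ _ _ (there t∈xs) (here refl) = inj₂ (there t∈xs)
    shared⇒head∈ {x} {x′ ∷ xs} {y} {y′ ∷ ys} (x→x′ ∷ xs↑) (y→y′ ∷ ys↑) (x∈T ∷ xs⊆T) (y∈T ∷ ys⊆T)
                 (there t∈xs) (there t∈ys)
      with shared⇒head∈ xs↑ ys↑ xs⊆T ys⊆T t∈xs t∈ys
    ... | inj₁ x′∈ys with predecessor (y→y′ ∷ ys↑) x′∈ys
    ...   | v , v∈ , v→x′ = inj₁ (subst (_∈ y ∷ y′ ∷ ys)
                              (Step-predecessor-unique (All.lookup (y∈T ∷ ys⊆T) v∈) x∈T v→x′ x→x′) v∈)
    shared⇒head∈ {x} {x′ ∷ xs} {y} {y′ ∷ ys} (x→x′ ∷ xs↑) (y→y′ ∷ ys↑) (x∈T ∷ xs⊆T) (y∈T ∷ ys⊆T)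
                 (there t∈xs) (there t∈ys)
        | inj₂ y′∈xs with predecessor (x→x′ ∷ xs↑) y′∈xs
    ...   | v , v∈ , v→y′ = inj₂ (subst (_∈ x ∷ x′ ∷ xs)
                              (Step-predecessor-unique (All.lookup (x∈T ∷ xs⊆T) v∈) y∈T v→y′ y→y′) v∈)

    same-head⇒≡ : ∀ {x xs ys} → Ascending c (x ∷ xs) → Ascending c (x ∷ ys) →
      All (_∈ T) xs → All (_∈ T) ys → length xs ≡ length ys → xs ≡ ys
    same-head⇒≡ {xs = []}     {[]}     _ _ _ _ _ = refl
    same-head⇒≡ {xs = x′ ∷ _} {y′ ∷ _} (x→x′ ∷ xs↑) (x→y′ ∷ ys↑) (x′∈T ∷ xs⊆T) (y′∈T ∷ ys⊆T) same-length
      with Step-successor-unique x′∈T y′∈T x→x′ x→y′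
    ... | refl = cong (x′ ∷_) (same-head⇒≡ xs↑ ys↑ xs⊆T ys⊆T (suc-injective same-length))

    Initial-ascents-≡ : ∀ {l₁ l₂ t} → Ascending c l₁ → Ascending c l₂ →
      All (_∈ T) l₁ → All (_∈ T) l₂ → Initial T c l₁ → Initial T c l₂ → length l₁ ≡ length l₂ →
      t ∈ l₁ → t ∈ l₂ → l₁ ≡ l₂
    Initial-ascents-≡ {x ∷ xs} {y ∷ ys} l₁↑ l₂↑ l₁⊆T l₂⊆T initial₁ initial₂ same-length t∈l₁ t∈l₂
      with heads-≡
      where
      heads-≡ : x ≡ y
      heads-≡ with shared⇒head∈ l₁↑ l₂↑ l₁⊆T l₂⊆T t∈l₁ t∈l₂
      ... | inj₁ (here x≡y) = x≡y
      ... | inj₂ (here y≡x) = sym y≡x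
      ... | inj₁ (there x∈ys) with predecessor l₂↑ x∈ys
      ...   | v , v∈ , v→x = ⊥-elim (initial₁ (All.lookup l₂⊆T v∈) (v→x ∷ l₁↑))
      heads-≡ | inj₂ (there y∈xs) with predecessor l₁↑ y∈xs
      ...   | v , v∈ , v→y = ⊥-elim (initial₂ (All.lookup l₁⊆T v∈) (v→y ∷ l₂↑))
    ... | refl = cong (x ∷_) (same-head⇒≡ l₁↑ l₂↑ (All.tail l₁⊆T) (All.tail l₂⊆T) (suc-injective same-length))

record Ascent (T r : List Tile) : Set where
  field
    class   : Dir
    tiles   : List Tile
    tiles≡  : tiles ≡ r ⊎ tiles ≡ reverse r
    linked  : Ascending class tiles
    initial : Initial T class tiles

module _ {T r : List Tile} (a : Ascent T r) where

  open Ascent a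

  ∈-tiles : ∀ {t} → t ∈ r → t ∈ tiles
  ∈-tiles t∈r with tiles≡
  ... | inj₁ refl = t∈r
  ... | inj₂ refl = reverse⁺ t∈r

  length-tiles : length tiles ≡ length r
  length-tiles with tiles≡
  ... | inj₁ refl = refl
  ... | inj₂ refl = length-reverse r

  tiles⊆T : All (_∈ T) r → All (_∈ T) tiles
  tiles⊆T r⊆T with tiles≡
  ... | inj₁ refl = r⊆T
  ... | inj₂ refl = All.tabulate (All.lookup r⊆T ∘ reverse⁻)

descending-reverse : ∀ {c l} → Linked (Step descending c) l → Ascending c (reverse l)
descending-reverse = Linked.map (Step-reverse descending) ∘ Linked-reverse

ascending-reverse : ∀ {c l} → Ascending c l → Linked (Step descending c) (reverse l)
ascending-reverse = Linked.map (Step-reverse ascending) ∘ Linked-reverse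

ascending-run-initial : ∀ {T c r} → IsRun T r → Ascending c r → Initial T c r
ascending-run-initial {T} {c} {r@(x ∷ y ∷ rest)} ((_ , unique , r⊆T) , maximal) r↑ {u} u∈T u∷r↑
  with maximal (u ∷ []) [] (subst (λ z → ChainIn T (u ∷ z)) (sym (++-identityʳ r))
         (Linked⇒IsChain ascending u∷r↑ , All.tabulate u∉r ∷ unique , u∈T ∷ r⊆T))
  where
  u∉r : ∀ {z} → z ∈ r → u ≢ z
  u∉r z∈r refl = Linked-head∉ u∷r↑ z∈r
... | () , _

descending-run-initial : ∀ {T c r} → IsRun T r → Linked (Step descending c) r → Initial T c (reverse r)
descending-run-initial {T} {c} {r@(x ∷ y ∷ rest)} ((_ , unique , r⊆T) , maximal) r↓ {u} u∈T u∷r↑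
  with maximal [] (u ∷ []) (Linked⇒IsChain descending r++u↓ ,
         Unique.++⁺ unique ([] ∷ []) u∉r , All.++⁺ r⊆T (u∈T ∷ []))
  where
  r++u↓ : Linked (Step descending c) (r ++ u ∷ [])
  r++u↓ = subst (Linked (Step descending c))
    (trans (unfold-reverse u (reverse r)) (cong (_++ u ∷ []) (reverse-involutive r)))
    (ascending-reverse u∷r↑)
  u∉r : ∀ {z} → ¬ (z ∈ r × z ∈ u ∷ [])
  u∉r (z∈r , here refl) = Linked-head∉ u∷r↑ (reverse⁺ z∈r)
... | _ , ()

IsRun⇒Ascent : ∀ {T} → NoOverlap T → ∀ {r} → IsRun T r → Ascent T r
IsRun⇒Ascent noOverlap {r} run with ChainIn⇒Linked noOverlap (proj₁ run)
... | c , ascending  , r↑ = record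
  { class = c ; tiles = r ; tiles≡ = inj₁ refl ; linked = r↑ ; initial = ascending-run-initial run r↑ }
... | c , descending , r↓ = record
  { class = c ; tiles = reverse r ; tiles≡ = inj₂ refl ; linked = descending-reverse r↓
  ; initial = descending-run-initial run r↓ }

module _ {T : List Tile} (noOverlap : NoOverlap T) {r s : List Tile}
         (a : Ascent T r) (b : Ascent T s) (r⊆T : All (_∈ T) r) (s⊆T : All (_∈ T) s) where

  open Ascent

  same-class⇒disjoint : class a ≡ class b → length r ≡ length s → r ≢ s → r ≢ reverse s →
                        Disjoint r s
  same-class⇒disjoint same-class same-length r≢s r≢s⁻¹ (t∈r , t∈s) =
    contradiction (tiles≡ a) (tiles≡ b)
    where
    tiles-≡ : tiles a ≡ tiles b
    tiles-≡ = Initial-ascents-≡ noOverlap (linked a)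
      (subst (λ c → Ascending c (tiles b)) (sym same-class) (linked b))
      (tiles⊆T a r⊆T) (tiles⊆T b s⊆T)
      (initial a) (subst (λ c → Initial T c (tiles b)) (sym same-class) (initial b))
      (trans (length-tiles a) (trans same-length (sym (length-tiles b))))
      (∈-tiles a t∈r) (∈-tiles b t∈s)
    contradiction : tiles a ≡ r ⊎ tiles a ≡ reverse r → tiles b ≡ s ⊎ tiles b ≡ reverse s → ⊥
    contradiction (inj₁ refl) (inj₁ refl) = r≢s tiles-≡
    contradiction (inj₁ refl) (inj₂ refl) = r≢s⁻¹ tiles-≡
    contradiction (inj₂ refl) (inj₁ refl) = r≢s⁻¹ (trans (sym (reverse-involutive r)) (cong reverse tiles-≡))
    contradiction (inj₂ refl) (inj₂ refl) = r≢s (reverse-injective tiles-≡)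

  different-class⇒meet-once : class a ≢ class b →
    ∀ {t v} → t ∈ r × t ∈ s → v ∈ r × v ∈ s → t ≡ v
  different-class⇒meet-once c≢c′ {t} {v} (t∈r , t∈s) (v∈r , v∈s) with t ≟ᵗ v
  ... | yes t≡v = t≡v
  ... | no t≢v  = ⊥-elim (tracks-meet-once c≢c′
    (AllPairs-∈ (Linked⇒AllPairs-Path (linked a)) (∈-tiles a t∈r) (∈-tiles a v∈r) t≢v)
    (AllPairs-∈ (Linked⇒AllPairs-Path (linked b)) (∈-tiles b t∈s) (∈-tiles b v∈s) t≢v))

runs-ColourSeparated : ∀ {T} (noOverlap : NoOverlap T) {r s} (run : IsRun T r) (run′ : IsRun T s) →
  length r ≡ length s → r ≢ s → r ≢ reverse s →
  ColourSeparated (Ascent.class (IsRun⇒Ascent noOverlap run)) r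
                  (Ascent.class (IsRun⇒Ascent noOverlap run′)) s
runs-ColourSeparated noOverlap run@((_ , _ , r⊆T) , _) run′@((_ , _ , s⊆T) , _)
                     same-length r≢s r≢s⁻¹ =
  (λ same-class → same-class⇒disjoint noOverlap a b r⊆T s⊆T same-class same-length r≢s r≢s⁻¹) ,
  different-class⇒meet-once noOverlap a b r⊆T s⊆T
  where
  a = IsRun⇒Ascent noOverlap run
  b = IsRun⇒Ascent noOverlap run′

-- Only distinctness, (P2) and the length of the runs enter.
proposition3 : (κ : ℕ) → 2 ≤ κ → (T : List Tile) → IsDoku κ T →
    (Rs : List (List Tile)) → RunList T Rs →
    κ * length Rs ∸ (length Rs * length Rs) / 3 ≤ length T
proposition3 κ _ T doku Rs (runs , _ , distinct) =
  subst (λ ρ → κ * ρ ∸ (ρ * ρ) / 3 ≤ length T) (length-toList runs)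
    (coloured-family-bound _≟ᵗ_ proj₁ colour T (IsDoku.distinct doku) (All.toList runs)
      (All-toList shape runs) (AllPairs-toList separated distinct runs))
  where
  noOverlap : NoOverlap T
  noOverlap = P2⇒NoOverlap (IsDoku.P2 doku)
  colour : ∃ (IsRun T) → Dir
  colour (_ , run) = Ascent.class (IsRun⇒Ascent noOverlap run)
  shape : ∀ {r} → IsRun T r → Unique r × All (_∈ T) r × length r ≡ κ
  shape run@((_ , unique , r⊆T) , _) = unique , r⊆T , IsDoku.runLength doku _ run
  separated : ∀ {r s} → r ≢ s × r ≢ reverse s → (run : IsRun T r) (run′ : IsRun T s) →
              ColourSeparated (colour (r , run)) r (colour (s , run′)) s
  separated (r≢s , r≢s⁻¹) run run′ = runs-ColourSeparated noOverlap run run′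
    (trans (IsDoku.runLength doku _ run) (sym (IsDoku.runLength doku _ run′))) r≢s r≢s⁻¹
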